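{- The Klein graph is a Cayley graph over the symmetric group $\mathrm{Sym}(4)$.
   Context: The Klein graph is the unique distance-regular graph with intersection array $\{7,4,1;1,2,7\}$ (an antipodal $3$-cover of $K_8$ on $24$ vertices). A connected graph is distance-regular with intersection array $\{b_0,\dots,b_{d-1};c_1,\dots,c_d\}$ if for all vertices $x,y$ at distance $i$, $y$ has exactly $c_i$ neighbours at distance $i-1$ from $x$ and exactly $b_i$ neighbours at distance $i+1$ from $x$. A graph is a Cayley graph over $G$ if it is isomorphic to $\mathrm{Cay}(G,S)$ for some inverse-closed $S\subseteq G\setminus\{e\}$, where $a\sim b$ iff $ab^{ -1}\in S$. -}

module Defs where

open import Level using (Level; _⊔_)
open import Data.Nat using (ℕ; zero; suc; _<_; _≤_)
open import Data.Fin using (Fin; toℕ)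
open import Data.Vec using (Vec; lookup)
open import Data.Product using (Σ; ∃; _×_; _,_)
open import Data.List using (List)
open import Data.List.Relation.Unary.Any using (Any)
open import Data.Fin.Permutation using (Permutation′; _⟨$⟩ʳ_; _⟨$⟩ˡ_)
open import Relation.Binary.PropositionalEquality using (_≡_)
open import Relation.Nullary using (¬_)

module GraphNotions {a ℓ e : Level} {V : Set a}
                    (_≈_ : V → V → Set ℓ) (Adj : V → V → Set e) where

  data Walk : ℕ → V → V → Set (a ⊔ ℓ ⊔ e) where
    here : ∀ {x y} → x ≈ y → Walk zero x y
    step : ∀ {n x z y} → Adj x z → Walk n z y → Walk (suc n) x y

  Dist : ℕ → V → V → Set (a ⊔ ℓ ⊔ e)
  Dist n x y = Walk n x y × (∀ m → m < n → ¬ Walk m x y)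

  HasExactly : ∀ {p} → ℕ → (V → Set p) → Set (a ⊔ ℓ ⊔ p)
  HasExactly k P =
    Σ (Fin k → V) λ v →
      (∀ i j → v i ≈ v j → i ≡ j) ×
      (∀ i → P (v i)) ×
      (∀ z → P z → ∃ λ i → z ≈ v i)

  -- distance-regular with intersection array
  -- {b₀,…,b_{d-1} ; c₁,…,c_d}  (b = [b₀ … b_{d-1}], c = [c₁ … c_d]).
  -- The diameter is d: the graph is connected and every two vertices
  -- are at distance at most d.
  IsDistanceRegular : (d : ℕ) → Vec ℕ d → Vec ℕ d → Set (a ⊔ ℓ ⊔ e)
  IsDistanceRegular d b c =
    (∀ x y → ∃ λ n → n ≤ d × Walk n x y) ×
    (∀ (i : Fin d) x y → Dist (toℕ i) x y →
       HasExactly (lookup b i) (λ z → Adj y z × Dist (suc (toℕ i)) x z)) ×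
    (∀ (i : Fin d) x y → Dist (suc (toℕ i)) x y →
       HasExactly (lookup c i) (λ z → Adj y z × Dist (toℕ i) x z))

Sym : ℕ → Set
Sym n = Permutation′ n

_≈ₚ_ : ∀ {n} → Sym n → Sym n → Set
σ ≈ₚ τ = ∀ i → σ ⟨$⟩ʳ i ≡ τ ⟨$⟩ʳ i

_∈ₚ_ : ∀ {n} → Sym n → List (Sym n) → Set
σ ∈ₚ S = Any (σ ≈ₚ_) S

ExcludesIdentity : ∀ {n} → List (Sym n) → Set
ExcludesIdentity S = ∀ σ → σ ∈ₚ S → ¬ (∀ i → σ ⟨$⟩ʳ i ≡ i)

InverseClosed : ∀ {n} → List (Sym n) → Set
InverseClosed S = ∀ σ → σ ∈ₚ S →
  Any (λ τ → ∀ i → σ ⟨$⟩ˡ i ≡ τ ⟨$⟩ʳ i) S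

CayAdj : ∀ {n} → List (Sym n) → Sym n → Sym n → Set
CayAdj S a b = Any (λ s → ∀ i → a ⟨$⟩ʳ (b ⟨$⟩ˡ i) ≡ s ⟨$⟩ʳ i) S

module Submission where

-- Right multiplications are automorphisms of a Cayley graph Cay(G, S), so it is
-- distance-regular as soon as the layers around the identity have the right
-- intersection numbers.  There the distance is certified by a labelling δ (here the
-- word length over S) with δ(e) = 0, δ(y) = 0 only at e, δ growing by at most one
-- along edges and every y ≠ e having a neighbour one step closer.  For Sym(4),
-- enumerated by recording the image of 0 and recursing on the rest, all remaining
-- conditions are finite checks over its 24 elements, decided by evaluation.

open import Defs
open import Level using (_⊔_)
open import Data.Bool using (true; false; if_then_else_)
open import Data.Fin using (Fin; toℕ; zero; suc; punchIn; combine; remQuot)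
open import Data.Fin.Patterns using (0F; 1F; 2F; 3F)
open import Data.Fin.Permutation as P
  using (_∘ₚ_; _⟨$⟩ʳ_; _⟨$⟩ˡ_; inverseˡ; inverseʳ; insert; remove; insert-punchIn; insert-remove)
import Data.Fin.Properties as Fin
open import Data.Fin.Properties using (punchIn-injective; combine-remQuot; remQuot-combine)
open import Data.List using (List; _∷_; []; length; filter; allFin; lookup; cartesianProductWith)
import Data.List.Relation.Unary.All as All
open import Data.List.Relation.Unary.AllPairs using (_∷_)
import Data.List.Relation.Unary.Any as Any
open import Data.List.Relation.Unary.Any.Properties using (lookup-index)
open import Data.List.Relation.Unary.Unique.Propositional using (Unique)
open import Data.List.Relation.Unary.Unique.Propositional.Properties using (allFin⁺; filter⁺)
open import Data.List.Membership.Propositional.Properties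
  using (∈-filter⁺; ∈-filter⁻; ∈-allFin; ∈-lookup)
open import Data.Nat using (ℕ; zero; suc; _+_; _≤_; _<_; _!; z≤n; s≤s)
import Data.Nat as ℕ
open import Data.Nat.Properties
  using (suc-injective; ≤-reflexive; +-monoʳ-≤; +-identityʳ; +-suc; m≤n⇒m<n∨m≡n; <⇒≱
        ; module ≤-Reasoning)
open import Data.Product using (Σ; ∃; _×_; _,_; proj₁; proj₂; uncurry)
open import Data.Product.Properties using (×-≡,≡→≡)
open import Data.Sum using (inj₁; inj₂)
open import Data.Vec using (Vec; _∷_; [])
import Data.Vec as Vec
open import Function using (_∘_)
open import Function.Bundles using (mk⇔)
open import Relation.Binary.Core using (Rel)
open import Relation.Binary.Definitions using (_Respects_; _Respects₂_)
open import Relation.Binary.Structures using (IsEquivalence)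
open import Relation.Binary.PropositionalEquality
  using (_≡_; refl; sym; trans; cong; cong₂; subst; subst₂; module ≡-Reasoning)
open import Relation.Nullary using (Dec; does; contradiction; _×-dec_; _→-dec_)
open import Relation.Nullary.Decidable using (from-yes; does-⇔; ¬?)
open import Relation.Unary using (Pred; Decidable)

lookup-injective : ∀ {a} {A : Set a} {xs : List A} → Unique xs →
                   ∀ {i j} → lookup xs i ≡ lookup xs j → i ≡ j
lookup-injective (_ ∷ _)   {zero}  {zero}  _     = refl
lookup-injective (x≢ ∷ _)  {zero}  {suc j} x≡xⱼ = contradiction x≡xⱼ (All.lookup x≢ (∈-lookup j))
lookup-injective (x≢ ∷ _)  {suc i} {zero}  xᵢ≡x = contradiction (sym xᵢ≡x) (All.lookup x≢ (∈-lookup i))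
lookup-injective (_ ∷ xs!) {suc i} {suc j} xᵢ≡xⱼ = cong suc (lookup-injective xs! xᵢ≡xⱼ)

record Enumeration {a ℓ} {V : Set a} (_≈_ : Rel V ℓ) (N : ℕ) : Set (a ⊔ ℓ) where
  field
    el           : Fin N → V
    code         : V → Fin N
    el∘code      : ∀ v → el (code v) ≈ v
    el-injective : ∀ {k l} → el k ≈ el l → k ≡ l

module GraphTheory {a ℓ e} {V : Set a} {_≈_ : Rel V ℓ} {Adj : Rel V e}
                   (≈-isEquivalence : IsEquivalence _≈_)
                   (Adj-resp : Adj Respects₂ _≈_) where

  open IsEquivalence ≈-isEquivalence public
    using (reflexive) renaming (refl to ≈-refl; sym to ≈-sym; trans to ≈-trans)
  open GraphNotions _≈_ Adj public

  adj-resp : ∀ {x x′ y y′} → x ≈ x′ → y ≈ y′ → Adj x y → Adj x′ y′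
  adj-resp x≈x′ y≈y′ = proj₂ Adj-resp x≈x′ ∘ proj₁ Adj-resp y≈y′

  walk-resp : ∀ {n x x′ y y′} → x ≈ x′ → y ≈ y′ → Walk n x y → Walk n x′ y′
  walk-resp x≈x′ y≈y′ (here x≈y)  = here (≈-trans (≈-sym x≈x′) (≈-trans x≈y y≈y′))
  walk-resp x≈x′ y≈y′ (step xz w) = step (proj₂ Adj-resp x≈x′ xz) (walk-resp ≈-refl y≈y′ w)

  walk-snoc : ∀ {n x y z} → Walk n x y → Adj y z → Walk (suc n) x z
  walk-snoc (here x≈y)  yz = step (proj₂ Adj-resp (≈-sym x≈y) yz) (here ≈-refl)
  walk-snoc (step xw w) yz = step xw (walk-snoc w yz)

  dist-resp : ∀ {n x x′ y y′} → x ≈ x′ → y ≈ y′ → Dist n x y → Dist n x′ y′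
  dist-resp x≈x′ y≈y′ (w , minimal) =
    walk-resp x≈x′ y≈y′ w ,
    λ m m<n w′ → minimal m m<n (walk-resp (≈-sym x≈x′) (≈-sym y≈y′) w′)

  hasExactly-cong : ∀ {p q k} {P : Pred V p} {Q : Pred V q} →
                    (∀ z → P z → Q z) → (∀ z → Q z → P z) →
                    HasExactly k P → HasExactly k Q
  hasExactly-cong P⇒Q Q⇒P (v , injective , sound , complete) =
    v , injective , (λ i → P⇒Q (v i) (sound i)) , λ z Qz → complete z (Q⇒P z Qz)

  record Automorphism : Set (a ⊔ ℓ ⊔ e) where
    field
      to from   : V → V
      to-cong   : ∀ {x y} → x ≈ y → to x ≈ to y
      from-cong : ∀ {x y} → x ≈ y → from x ≈ from y
      to-adj    : ∀ {x y} → Adj x y → Adj (to x) (to y)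
      from-adj  : ∀ {x y} → Adj x y → Adj (from x) (from y)
      from∘to   : ∀ x → from (to x) ≈ x
      to∘from   : ∀ x → to (from x) ≈ x

  open Automorphism

  inverse : Automorphism → Automorphism
  inverse φ = record
    { to = from φ ; from = to φ ; to-cong = from-cong φ ; from-cong = to-cong φ
    ; to-adj = from-adj φ ; from-adj = to-adj φ ; from∘to = to∘from φ ; to∘from = from∘to φ }

  walk-map : ∀ (φ : Automorphism) {n x y} → Walk n x y → Walk n (to φ x) (to φ y)
  walk-map φ (here x≈y)  = here (to-cong φ x≈y)
  walk-map φ (step xz w) = step (to-adj φ xz) (walk-map φ w)

  walk-comap : ∀ (φ : Automorphism) {n x y} → Walk n (to φ x) (to φ y) → Walk n x y
  walk-comap φ = walk-resp (from∘to φ _) (from∘to φ _) ∘ walk-map (inverse φ)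

  dist-map : ∀ (φ : Automorphism) {n x y} → Dist n x y → Dist n (to φ x) (to φ y)
  dist-map φ (w , minimal) = walk-map φ w , λ m m<n w′ → minimal m m<n (walk-comap φ w′)

  hasExactly-transport : ∀ (φ : Automorphism) {p q k} {P : Pred V p} {Q : Pred V q} →
                         (∀ z → P z → Q (to φ z)) → (∀ z → Q z → P (from φ z)) →
                         HasExactly k Q → HasExactly k P
  hasExactly-transport φ P⇒Q Q⇒P (v , injective , sound , complete) =
    from φ ∘ v ,
    (λ i j φ⁻¹vᵢ≈φ⁻¹vⱼ → injective i j (≈-trans (≈-sym (to∘from φ _))
                                        (≈-trans (to-cong φ φ⁻¹vᵢ≈φ⁻¹vⱼ) (to∘from φ _)))) ,
    (λ i → Q⇒P (v i) (sound i)) ,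
    λ z Pz → let i , φz≈vᵢ = complete (to φ z) (P⇒Q z Pz) in
             i , ≈-trans (≈-sym (from∘to φ z)) (from-cong φ φz≈vᵢ)

  module VertexTransitive (b : V) (toBase : ∀ x → Σ Automorphism λ φ → to φ x ≈ b) where

    neighbours-fromBase :
      ∀ {k m m′} → (∀ y → Dist m b y → HasExactly k (λ z → Adj y z × Dist m′ b z)) →
      ∀ x y → Dist m x y → HasExactly k (λ z → Adj y z × Dist m′ x z)
    neighbours-fromBase atBase x y dxy =
      hasExactly-transport φ
        (λ z (yz , dxz) → to-adj φ yz , dist-resp φx≈b ≈-refl (dist-map φ dxz))
        (λ z (φy-z , dbz) → proj₂ Adj-resp (from∘to φ y) (from-adj φ φy-z) ,
                            dist-resp φ⁻¹b≈x ≈-refl (dist-map (inverse φ) dbz))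
        (atBase (to φ y) (dist-resp φx≈b ≈-refl (dist-map φ dxy)))
      where
      φ : Automorphism
      φ = proj₁ (toBase x)
      φx≈b : to φ x ≈ b
      φx≈b = proj₂ (toBase x)
      φ⁻¹b≈x : from φ b ≈ x
      φ⁻¹b≈x = ≈-trans (from-cong φ (≈-sym φx≈b)) (from∘to φ x)

    isDistanceRegular-fromBase :
      ∀ {d} (bs cs : Vec ℕ d) →
      (∀ y → ∃ λ n → n ≤ d × Walk n b y) →
      (∀ (i : Fin d) y → Dist (toℕ i) b y →
         HasExactly (Vec.lookup bs i) (λ z → Adj y z × Dist (suc (toℕ i)) b z)) →
      (∀ (i : Fin d) y → Dist (suc (toℕ i)) b y →
         HasExactly (Vec.lookup cs i) (λ z → Adj y z × Dist (toℕ i) b z)) →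
      IsDistanceRegular d bs cs
    isDistanceRegular-fromBase {d} bs cs reach bᵢ cᵢ =
      connected , (λ i → neighbours-fromBase (bᵢ i)) , (λ i → neighbours-fromBase (cᵢ i))
      where
      connected : ∀ x y → ∃ λ n → n ≤ d × Walk n x y
      connected x y =
        let φ , φx≈b = toBase x ; n , n≤d , w = reach (to φ y) in
        n , n≤d , walk-comap φ (walk-resp (≈-sym φx≈b) ≈-refl w)

  module DistanceLabelling
    (b : V) (δ : V → ℕ)
    (δ-resp   : ∀ {y z} → y ≈ z → δ y ≡ δ z)
    (δ-base   : δ b ≡ 0)
    (δ-zero   : ∀ y → δ y ≡ 0 → b ≈ y)
    (δ-adj    : ∀ {y z} → Adj y z → δ z ≤ suc (δ y))
    (δ-parent : ∀ y {n} → δ y ≡ suc n → ∃ λ x → Adj x y × δ x ≡ n) where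

    walk⇒δ≤+ : ∀ {n x y} → Walk n x y → δ y ≤ n + δ x
    walk⇒δ≤+ (here x≈y) = ≤-reflexive (δ-resp (≈-sym x≈y))
    walk⇒δ≤+ {suc n} {x} {y} (step {z = z} xz w) = begin
      δ y           ≤⟨ walk⇒δ≤+ w ⟩
      n + δ z       ≤⟨ +-monoʳ-≤ n (δ-adj xz) ⟩
      n + suc (δ x) ≡⟨ +-suc n (δ x) ⟩
      suc n + δ x   ∎
      where open ≤-Reasoning

    walk⇒δ≤ : ∀ {n y} → Walk n b y → δ y ≤ n
    walk⇒δ≤ {n} w = subst (_ ≤_) (trans (cong (n +_) δ-base) (+-identityʳ n)) (walk⇒δ≤+ w)

    δ⇒walk : ∀ {n} y → δ y ≡ n → Walk n b y
    δ⇒walk {zero}  y δy≡0   = here (δ-zero y δy≡0)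
    δ⇒walk {suc n} y δy≡1+n =
      let x , xy , δx≡n = δ-parent y δy≡1+n in walk-snoc (δ⇒walk x δx≡n) xy

    δ⇒dist : ∀ {n} y → δ y ≡ n → Dist n b y
    δ⇒dist y δy≡n@refl = δ⇒walk y δy≡n , λ m m<n w → <⇒≱ m<n (walk⇒δ≤ w)

    dist⇒δ : ∀ {n} y → Dist n b y → δ y ≡ n
    dist⇒δ y (w , minimal) with m≤n⇒m<n∨m≡n (walk⇒δ≤ w)
    ... | inj₁ δy<n = contradiction (δ⇒walk y refl) (minimal _ δy<n)
    ... | inj₂ δy≡n = δy≡n

  module _ {N} (E : Enumeration _≈_ N) where
    open Enumeration E

    ∀-fromCodes : ∀ {p} {P : Pred V p} → P Respects _≈_ → (∀ k → P (el k)) → ∀ v → P v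
    ∀-fromCodes P-resp P-el v = P-resp (el∘code v) (P-el (code v))

    adj-viaCodes : ∀ {x y} → Adj x y → Adj (el (code x)) (el (code y))
    adj-viaCodes = adj-resp (≈-sym (el∘code _)) (≈-sym (el∘code _))

    count : ∀ {p} {P : Pred V p} → Decidable P → ℕ
    count P? = length (filter (P? ∘ el) (allFin N))

    hasExactly-count : ∀ {p} {P : Pred V p} → P Respects _≈_ → (P? : Decidable P) →
                       HasExactly (count P?) P
    hasExactly-count P-resp P? =
      el ∘ lookup ws ,
      (λ i j → lookup-injective (filter⁺ (P? ∘ el) (allFin⁺ N)) ∘ el-injective) ,
      (λ i → proj₂ (∈-filter⁻ (P? ∘ el) {xs = allFin N} (∈-lookup i))) ,
      λ z Pz → let z∈ws = ∈-filter⁺ (P? ∘ el) (∈-allFin (code z)) (P-resp (≈-sym (el∘code z)) Pz) in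
               Any.index z∈ws ,
               ≈-trans (≈-sym (el∘code z)) (reflexive (cong el (lookup-index z∈ws)))
      where ws = filter (P? ∘ el) (allFin N)

≈ₚ-isEquivalence : ∀ {n} → IsEquivalence (_≈ₚ_ {n})
≈ₚ-isEquivalence = record
  { refl = λ _ → refl ; sym = λ σ≈τ i → sym (σ≈τ i) ; trans = λ σ≈τ τ≈ρ i → trans (σ≈τ i) (τ≈ρ i) }

_≈ₚ?_ : ∀ {n} (σ τ : Sym n) → Dec (σ ≈ₚ τ)
σ ≈ₚ? τ = Fin.all? λ i → σ ⟨$⟩ʳ i Fin.≟ τ ⟨$⟩ʳ i

inverse-cong : ∀ {n} {σ τ : Sym n} → σ ≈ₚ τ → ∀ i → σ ⟨$⟩ˡ i ≡ τ ⟨$⟩ˡ i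
inverse-cong {σ = σ} {τ} σ≈τ i = begin
  σ ⟨$⟩ˡ i                   ≡⟨ cong (σ ⟨$⟩ˡ_) (inverseʳ τ) ⟨
  σ ⟨$⟩ˡ (τ ⟨$⟩ʳ (τ ⟨$⟩ˡ i)) ≡⟨ cong (σ ⟨$⟩ˡ_) (σ≈τ (τ ⟨$⟩ˡ i)) ⟨
  σ ⟨$⟩ˡ (σ ⟨$⟩ʳ (τ ⟨$⟩ˡ i)) ≡⟨ inverseˡ σ ⟩
  τ ⟨$⟩ˡ i                   ∎
  where open ≡-Reasoning

insert₀-cong : ∀ {n} i {π ρ : Sym n} → π ≈ₚ ρ → insert zero i π ≈ₚ insert zero i ρ
insert₀-cong i         π≈ρ zero    = refl
insert₀-cong i {π} {ρ} π≈ρ (suc k) = begin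
  insert zero i π ⟨$⟩ʳ suc k ≡⟨ insert-punchIn zero i π k ⟩
  punchIn i (π ⟨$⟩ʳ k)       ≡⟨ cong (punchIn i) (π≈ρ k) ⟩
  punchIn i (ρ ⟨$⟩ʳ k)       ≡⟨ insert-punchIn zero i ρ k ⟨
  insert zero i ρ ⟨$⟩ʳ suc k ∎
  where open ≡-Reasoning

insert₀-injective : ∀ {n} {i j} {π ρ : Sym n} →
                    insert zero i π ≈ₚ insert zero j ρ → i ≡ j × π ≈ₚ ρ
insert₀-injective {i = i} {π = π} {ρ} ins≈ins with refl ← ins≈ins zero =
  refl , λ k → punchIn-injective i _ _ (begin
    punchIn i (π ⟨$⟩ʳ k)       ≡⟨ insert-punchIn zero i π k ⟨
    insert zero i π ⟨$⟩ʳ suc k ≡⟨ ins≈ins (suc k) ⟩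
    insert zero i ρ ⟨$⟩ʳ suc k ≡⟨ insert-punchIn zero i ρ k ⟩
    punchIn i (ρ ⟨$⟩ʳ k)       ∎)
  where open ≡-Reasoning

perm : ∀ n → Fin (n !) → Sym n
perm zero    _ = P.id
perm (suc n) k = let i , r = remQuot {suc n} (n !) k in insert zero i (perm n r)

permIndex : ∀ n → Sym n → Fin (n !)
permIndex zero    _ = zero
permIndex (suc n) σ = combine (σ ⟨$⟩ʳ zero) (permIndex n (remove zero σ))

perm-injective : ∀ n {k l} → perm n k ≈ₚ perm n l → k ≡ l
perm-injective zero    {zero} {zero} _ = refl
perm-injective (suc n) {k} {l} πₖ≈πₗ =
  let i≡j , π≈ρ = insert₀-injective πₖ≈πₗ in begin
    k                         ≡⟨ combine-remQuot (n !) k ⟨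
    uncurry combine (split k) ≡⟨ cong (uncurry combine) (×-≡,≡→≡ (i≡j , perm-injective n π≈ρ)) ⟩
    uncurry combine (split l) ≡⟨ combine-remQuot (n !) l ⟩
    l                         ∎
  where
  open ≡-Reasoning
  split : Fin (suc n !) → Fin (suc n) × Fin (n !)
  split = remQuot (n !)

perm∘permIndex : ∀ n (σ : Sym n) → perm n (permIndex n σ) ≈ₚ σ
perm∘permIndex zero    σ ()
perm∘permIndex (suc n) σ i = begin
  perm (suc n) (combine σ₀ (permIndex n σ′)) ⟨$⟩ʳ i
    ≡⟨ cong (λ (j , r) → insert zero j (perm n r) ⟨$⟩ʳ i) (remQuot-combine {k = n !} σ₀ _) ⟩
  insert zero σ₀ (perm n (permIndex n σ′)) ⟨$⟩ʳ i
    ≡⟨ insert₀-cong σ₀ (perm∘permIndex n σ′) i ⟩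
  insert zero σ₀ σ′ ⟨$⟩ʳ i
    ≡⟨ insert-remove zero σ i ⟩
  σ ⟨$⟩ʳ i ∎
  where
  open ≡-Reasoning
  σ₀ : Fin (suc n)
  σ₀ = σ ⟨$⟩ʳ zero
  σ′ : Sym n
  σ′ = remove zero σ

symEnumeration : ∀ n → Enumeration _≈ₚ_ (n !)
symEnumeration n = record
  { el           = perm n
  ; code         = permIndex n
  ; el∘code      = perm∘permIndex n
  ; el-injective = perm-injective n
  }

module Cayley {n} (S : List (Sym n)) where

  cayAdj-resp : CayAdj S Respects₂ _≈ₚ_
  cayAdj-resp =
    (λ {a} {b} {b′} b≈b′ → Any.map λ ab⁻¹≈s i →
      trans (cong (a ⟨$⟩ʳ_) (inverse-cong {σ = b′} {b} (λ j → sym (b≈b′ j)) i)) (ab⁻¹≈s i)) ,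
    (λ a≈a′ → Any.map λ ab⁻¹≈s i → trans (sym (a≈a′ _)) (ab⁻¹≈s i))

  cayAdj? : ∀ a b → Dec (CayAdj S a b)
  cayAdj? a b = Any.any? (λ s → Fin.all? λ i → a ⟨$⟩ʳ (b ⟨$⟩ˡ i) Fin.≟ s ⟨$⟩ʳ i) S

  open GraphTheory ≈ₚ-isEquivalence cayAdj-resp public

  rightMultiplication : Sym n → Automorphism
  rightMultiplication g = record
    { to        = g ∘ₚ_
    ; from      = P.flip g ∘ₚ_
    ; to-cong   = λ σ≈τ i → σ≈τ (g ⟨$⟩ʳ i)
    ; from-cong = λ σ≈τ i → σ≈τ (g ⟨$⟩ˡ i)
    ; to-adj    = λ {a} → Any.map λ ab⁻¹≈s i → trans (cong (a ⟨$⟩ʳ_) (inverseʳ g)) (ab⁻¹≈s i)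
    ; from-adj  = λ {a} → Any.map λ ab⁻¹≈s i → trans (cong (a ⟨$⟩ʳ_) (inverseˡ g)) (ab⁻¹≈s i)
    ; from∘to   = λ σ i → cong (σ ⟨$⟩ʳ_) (inverseʳ g)
    ; to∘from   = λ σ i → cong (σ ⟨$⟩ʳ_) (inverseˡ g)
    }

  toIdentity : ∀ x → Σ Automorphism λ φ → Automorphism.to φ x ≈ₚ P.id
  toIdentity x = rightMultiplication (P.flip x) , λ i → inverseʳ x

  _⊙_ : List (Sym n) → List (Sym n) → List (Sym n)
  _⊙_ = cartesianProductWith _∘ₚ_

  layerIndex : ℕ → List (Sym n) → Sym n → ℕ
  layerIndex zero    _     _ = zero
  layerIndex (suc d) layer σ =
    if does (Any.any? (σ ≈ₚ?_) layer) then zero else suc (layerIndex d (S ⊙ layer) σ)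

  layerIndex-≤ : ∀ d layer σ → layerIndex d layer σ ≤ d
  layerIndex-≤ zero    _     _ = z≤n
  layerIndex-≤ (suc d) layer σ with does (Any.any? (σ ≈ₚ?_) layer)
  ... | true  = z≤n
  ... | false = s≤s (layerIndex-≤ d (S ⊙ layer) σ)

  layerIndex-resp : ∀ d layer {σ τ} → σ ≈ₚ τ → layerIndex d layer σ ≡ layerIndex d layer τ
  layerIndex-resp zero    _     _   = refl
  layerIndex-resp (suc d) layer {σ} {τ} σ≈τ =
    cong₂ (λ found rest → if found then zero else suc rest)
      (does-⇔ (mk⇔ (Any.map λ σ≈ρ i → trans (sym (σ≈τ i)) (σ≈ρ i))
                   (Any.map λ τ≈ρ i → trans (σ≈τ i) (τ≈ρ i)))
              (Any.any? (σ ≈ₚ?_) layer) (Any.any? (τ ≈ₚ?_) layer))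
      (layerIndex-resp d (S ⊙ layer) σ≈τ)

module KleinGraph where

  t₀₁ t₀₂ t₁₂ t₁₃ t₂₃ : Sym 4
  t₀₁ = P.transpose 0F 1F
  t₀₂ = P.transpose 0F 2F
  t₁₂ = P.transpose 1F 2F
  t₁₃ = P.transpose 1F 3F
  t₂₃ = P.transpose 2F 3F

  -- σ ∘ₚ τ applies σ first, so c₃ = (0 2 1) and c₄ = (0 1 3 2).
  c₃ c₄ : Sym 4
  c₃ = t₀₁ ∘ₚ t₁₂
  c₄ = t₂₃ ∘ₚ t₁₃ ∘ₚ t₀₁

  S : List (Sym 4)
  S = t₁₂ ∷ t₂₃ ∷ t₀₂ ∘ₚ t₁₃ ∷ c₃ ∷ P.flip c₃ ∷ c₄ ∷ P.flip c₄ ∷ []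

  intersectionB intersectionC : Vec ℕ 3
  intersectionB = 7 ∷ 4 ∷ 1 ∷ []
  intersectionC = 1 ∷ 2 ∷ 7 ∷ []

  open Cayley S

  Sym₄ : Enumeration _≈ₚ_ (4 !)
  Sym₄ = symEnumeration 4
  open Enumeration Sym₄

  inverseClosed : InverseClosed S
  inverseClosed σ = All.lookupWith
    (λ {s} s⁻¹∈S σ≈s → Any.map (λ s⁻¹≈τ i → trans (inverse-cong {σ = σ} {s} σ≈s i) (s⁻¹≈τ i)) s⁻¹∈S)
    (from-yes (All.all? (λ s → Any.any? (P.flip s ≈ₚ?_) S) S))

  excludesIdentity : ExcludesIdentity S
  excludesIdentity σ = All.lookupWith
    (λ s≉id σ≈s σ≈id → s≉id (λ i → trans (sym (σ≈s i)) (σ≈id i)))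
    (from-yes (All.all? (λ s → ¬? (s ≈ₚ? P.id)) S))

  -- Word length over S, capped at the diameter; the checks below show that it is
  -- the distance from the identity.
  δ : Sym 4 → ℕ
  δ = layerIndex 3 (P.id ∷ [])

  δ-resp : ∀ {y z} → y ≈ₚ z → δ y ≡ δ z
  δ-resp {y} {z} = layerIndex-resp 3 (P.id ∷ []) {y} {z}

  δ∘el∘code : ∀ y → δ (el (code y)) ≡ δ y
  δ∘el∘code y = δ-resp {el (code y)} {y} (el∘code y)

  δ-identity : δ P.id ≡ 0
  δ-identity = refl

  δ-zero : ∀ y → δ y ≡ 0 → P.id ≈ₚ y
  δ-zero = ∀-fromCodes Sym₄
    (λ {y} {y′} y≈y′ δy≡0⇒id≈y δy′≡0 i →
      trans (δy≡0⇒id≈y (trans (δ-resp {y} {y′} y≈y′) δy′≡0) i) (y≈y′ i))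
    (from-yes (Fin.all? λ k → δ (el k) ℕ.≟ 0 →-dec P.id ≈ₚ? el k))

  δ-adj : ∀ {y z} → CayAdj S y z → δ z ≤ suc (δ y)
  δ-adj {y} {z} yz =
    subst₂ (λ δz δy → δz ≤ suc δy) (δ∘el∘code z) (δ∘el∘code y)
      (onCodes (code y) (code z) (adj-viaCodes Sym₄ {y} {z} yz))
    where
    onCodes : ∀ k l → CayAdj S (el k) (el l) → δ (el l) ≤ suc (δ (el k))
    onCodes = from-yes (Fin.all? λ k → Fin.all? λ l →
      cayAdj? (el k) (el l) →-dec δ (el l) ℕ.≤? suc (δ (el k)))

  δ-parent-onCodes : ∀ k → 0 < δ (el k) → ∃ λ l → CayAdj S (el l) (el k) × suc (δ (el l)) ≡ δ (el k)
  δ-parent-onCodes = from-yes (Fin.all? λ k → 0 ℕ.<? δ (el k) →-dec Fin.any? λ l →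
    cayAdj? (el l) (el k) ×-dec suc (δ (el l)) ℕ.≟ δ (el k))

  δ-parent : ∀ y {n} → δ y ≡ suc n → ∃ λ x → CayAdj S x y × δ x ≡ n
  δ-parent y {n} δy≡1+n =
    parent (δ-parent-onCodes (code y) (subst (0 <_) (sym δŷ≡1+n) (s≤s z≤n)))
    where
    δŷ≡1+n : δ (el (code y)) ≡ suc n
    δŷ≡1+n = trans (δ∘el∘code y) δy≡1+n
    parent : (∃ λ l → CayAdj S (el l) (el (code y)) × suc (δ (el l)) ≡ δ (el (code y))) →
             ∃ λ x → CayAdj S x y × δ x ≡ n
    parent (l , lŷ , δl≡δŷ) =
      el l ,
      proj₁ cayAdj-resp {el l} {el (code y)} {y} (el∘code y) lŷ ,
      suc-injective (trans δl≡δŷ δŷ≡1+n)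

  open DistanceLabelling P.id δ (λ {y} {z} → δ-resp {y} {z}) δ-identity δ-zero
                                (λ {y} {z} → δ-adj {y} {z}) δ-parent

  neighboursAt : ℕ → Sym 4 → Sym 4 → Set
  neighboursAt m y z = CayAdj S y z × δ z ≡ m

  neighboursAt-resp : ∀ m y → neighboursAt m y Respects _≈ₚ_
  neighboursAt-resp m y {z} {z′} z≈z′ (yz , δz≡m) =
    proj₁ cayAdj-resp {y} {z} {z′} z≈z′ yz , trans (sym (δ-resp {z} {z′} z≈z′)) δz≡m

  neighboursAt? : ∀ m y → Decidable (neighboursAt m y)
  neighboursAt? m y z = cayAdj? y z ×-dec δ z ℕ.≟ m

  neighbours-atIdentity :
    ∀ {m m′ c} → (∀ k → δ (el k) ≡ m → count Sym₄ (neighboursAt? m′ (el k)) ≡ c) →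
    ∀ y → Dist m P.id y → HasExactly c (λ z → CayAdj S y z × Dist m′ P.id z)
  neighbours-atIdentity {m} {m′} {c} onCodes y dy =
    hasExactly-cong {P = neighboursAt m′ ŷ} {Q = λ z → CayAdj S y z × Dist m′ P.id z}
      (λ z (ŷz , δz≡m′) → proj₂ cayAdj-resp {z} {ŷ} {y} (el∘code y) ŷz , δ⇒dist z δz≡m′)
      (λ z (yz , dz) → proj₂ cayAdj-resp {z} {y} {ŷ} (λ i → sym (el∘code y i)) yz , dist⇒δ z dz)
      (subst (λ c → HasExactly c (neighboursAt m′ ŷ)) (onCodes (code y) δŷ≡m)
        (hasExactly-count Sym₄ {P = neighboursAt m′ ŷ}
          (λ {z} {z′} → neighboursAt-resp m′ ŷ {z} {z′}) (neighboursAt? m′ ŷ)))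
    where
    ŷ : Sym 4
    ŷ = el (code y)
    δŷ≡m : δ ŷ ≡ m
    δŷ≡m = trans (δ∘el∘code y) (dist⇒δ y dy)

  farther-onCodes : ∀ (i : Fin 3) k → δ (el k) ≡ toℕ i →
                    count Sym₄ (neighboursAt? (suc (toℕ i)) (el k)) ≡ Vec.lookup intersectionB i
  farther-onCodes = from-yes (Fin.all? λ i → Fin.all? λ k → δ (el k) ℕ.≟ toℕ i →-dec
    count Sym₄ (neighboursAt? (suc (toℕ i)) (el k)) ℕ.≟ Vec.lookup intersectionB i)

  nearer-onCodes : ∀ (i : Fin 3) k → δ (el k) ≡ suc (toℕ i) →
                   count Sym₄ (neighboursAt? (toℕ i) (el k)) ≡ Vec.lookup intersectionC i
  nearer-onCodes = from-yes (Fin.all? λ i → Fin.all? λ k → δ (el k) ℕ.≟ suc (toℕ i) →-dec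
    count Sym₄ (neighboursAt? (toℕ i) (el k)) ℕ.≟ Vec.lookup intersectionC i)

  isDistanceRegular : IsDistanceRegular 3 intersectionB intersectionC
  isDistanceRegular = VertexTransitive.isDistanceRegular-fromBase P.id toIdentity
    intersectionB intersectionC
    (λ y → δ y , layerIndex-≤ 3 (P.id ∷ []) y , δ⇒walk y refl)
    (λ i → neighbours-atIdentity (farther-onCodes i))
    (λ i → neighbours-atIdentity (nearer-onCodes i))

proposition7p1 : Σ (List (Sym 4)) λ S →
    InverseClosed S × ExcludesIdentity S ×
    GraphNotions.IsDistanceRegular _≈ₚ_ (CayAdj S) 3
      (7 ∷ 4 ∷ 1 ∷ []) (1 ∷ 2 ∷ 7 ∷ [])
proposition7p1 = S , inverseClosed , excludesIdentity , isDistanceRegular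
  where open KleinGraph
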